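{- Let $p\ge 5$ be a prime and let $D$ be a nontrivial regular $(v,k,\lambda,\mu)$-PDS in an Abelian group of order $v=8p^3$ with $k\le v/2$. If $\Delta=(\lambda-\mu)^2+4(k-\mu)=16p^2$, then either $\mu=2p+2$ or $\mu=2p-2$.
   Context: Let $G$ be a finite Abelian group of order $v$ with identity $e$, and $D\subseteq G$ a subset of size $k$. $D$ is a $(v,k,\lambda,\mu)$-partial difference set (PDS) in $G$ if the expressions $gh^{ -1}$ with $g,h\in D$, $g\neq h$, represent each non-identity element of $D$ exactly $\lambda$ times and each non-identity element of $G$ not in $D$ exactly $\mu$ times. $D$ is regular if moreover $D^{(-1)}=D$ and $e\notin D$. A regular PDS $D$ is trivial if $D\cup\{e\}$ or $G\setminus D$ is a subgroup of $G$. -}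

module Defs where

open import Level using (0ℓ)
open import Algebra.Bundles using (AbelianGroup)
open import Data.Nat using (ℕ; zero; suc; _+_; _*_; _≤_)
open import Data.Fin using (Fin; zero; suc)
open import Data.Product using (_×_; Σ)
open import Data.Sum using (_⊎_)
open import Relation.Nullary using (¬_; Dec; yes; no; _×-dec_; ¬?)
open import Relation.Unary using (Pred; Decidable)
open import Relation.Binary.PropositionalEquality using (_≡_)

count : ∀ {n} {P : Pred (Fin n) 0ℓ} → Decidable P → ℕ
count {zero} P? = 0
count {suc n} P? with P? zero
... | yes _ = suc (count (λ i → P? (suc i)))
... | no  _ = count (λ i → P? (suc i))

sumFin : ∀ {n} → (Fin n → ℕ) → ℕ
sumFin {zero} f = 0
sumFin {suc n} f = f zero + sumFin (λ i → f (suc i))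

record FiniteAbelianGroup (v : ℕ) : Set₁ where
  field
    grp    : AbelianGroup 0ℓ 0ℓ
  open AbelianGroup grp public
  field
    _≟_       : (x y : Carrier) → Dec (x ≈ y)
    enum      : Fin v → Carrier
    enum-inj  : ∀ i j → enum i ≈ enum j → i ≡ j
    enum-surj : ∀ x → Σ (Fin v) (λ i → enum i ≈ x)

module _ {v : ℕ} (G : FiniteAbelianGroup v) where
  open FiniteAbelianGroup G

  record Subset : Set₁ where
    field
      mem   : Carrier → Set
      mem?  : (x : Carrier) → Dec (mem x)
      resp  : ∀ {x y} → x ≈ y → mem x → mem y

  open Subset public

  size : Subset → ℕ
  size D = count (λ i → mem? D (enum i))

  nreps : Subset → Carrier → ℕ
  nreps D x = sumFin (λ i → count (λ j →
      mem? D (enum i) ×-dec (mem? D (enum j) ×-dec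
        (¬? (enum i ≟ enum j) ×-dec ((enum i ∙ (enum j ⁻¹)) ≟ x)))))

  -- (v,k,λ,μ)-partial difference set (v is the group order)
  record IsPDS (D : Subset) (k lam mu : ℕ) : Set where
    field
      size-D : size D ≡ k
      onD    : ∀ x → ¬ (x ≈ ε) → mem D x → nreps D x ≡ lam
      offD   : ∀ x → ¬ (x ≈ ε) → ¬ mem D x → nreps D x ≡ mu

  record IsRegular (D : Subset) : Set where
    field
      inv-closed : ∀ x → mem D x → mem D (x ⁻¹)
      no-id      : ¬ mem D ε

  record IsSubgroup (S : Carrier → Set) : Set where
    field
      has-ε  : S ε
      ∙-cl   : ∀ x y → S x → S y → S (x ∙ y)
      ⁻¹-cl  : ∀ x → S x → S (x ⁻¹)

  withId : Subset → Carrier → Set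
  withId D x = mem D x ⊎ (x ≈ ε)

  compl : Subset → Carrier → Set
  compl D x = ¬ mem D x

  IsTrivial : Subset → Set
  IsTrivial D = IsSubgroup (withId D) ⊎ IsSubgroup (compl D)

module Submission where

-- Proof plan.  Put v = 8p³, let c = v − k − 1 be the number of non-identity elements
-- outside D, and δ = 4p, so that the hypothesis reads Δ = δ².
--
-- Counting: counting the ordered pairs of distinct elements of D by their quotient gives
-- the standard identities  λk + μc + k = k²  and  c + k + 1 = v;  if μ = 0 then D ∪ {e} is
-- closed under products, so nontriviality forces μ ≥ 1.  (FiniteSums provides the sum
-- manipulations, Discriminant turns the integer hypothesis Δ = δ² into an identity in ℕ.)
--
-- ParameterArithmetic: with the eigenvalues r, s of D and t = 2k + μ − λ = (k − r) + (k − s),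
-- these identities give  t² = δ² + 4vμ  (that is, (k − r)(k − s) = vμ)  and  2t ≤ 4μ + δ² + 1.
-- Multiplied by v the latter bounds the parabola t(2v − t) from above.
--
-- EightPCubed: for v = 8p³ that bound excludes 10p² ≤ t ≤ 2v − 10p², and t ≤ 3k ≤ 3v/2, so
-- t < 10p².  Then n = t − 4p = 2(k − r) satisfies n(n + 8p) = 32p³μ with n < 10p²; so p ∣ n,
-- n = 8Rp with 2R(R + 1) = pμ and 8R < 10p, and as p ∣ R or p ∣ R + 1 (NumberTheory) only
-- R = p, giving μ = 2p + 2, or R + 1 = p, giving μ = 2p − 2, remain.

open import Defs
open import Data.Nat using (ℕ; _+_; _*_; _∸_; _^_; _≤_)
open import Data.Nat.Primality using (Prime)
open import Data.Sum using (_⊎_)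
open import Relation.Nullary using (¬_)
open import Relation.Binary.PropositionalEquality using (_≡_)

module FiniteSums where
  open import Level using (0ℓ)
  open import Data.Nat using (zero; suc)
  open import Data.Nat.Properties using (+-*-semiring; +-identityʳ; m≤m+n; m≤n+m; ≤-trans)
  open import Data.Fin using (Fin; zero; suc)
  open import Data.Fin.Properties using (suc-injective)
  open import Function using (_∘_)
  open import Relation.Nullary using (Dec; yes; no; _×-dec_; ¬?; contradiction)
  open import Relation.Unary using (Pred; Decidable)
  open import Relation.Binary.PropositionalEquality using (_≢_; refl; trans; cong; cong₂)
  open import Algebra.Properties.Semiring.Sum +-*-semiring using (sum; sum-cong-≗; sum-replicate-zero)

  𝟙 : ∀ {A : Set} → Dec A → ℕ
  𝟙 (yes _) = 1
  𝟙 (no _)  = 0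

  𝟙-yes : ∀ {A : Set} (d : Dec A) → A → 𝟙 d ≡ 1
  𝟙-yes (yes _) _ = refl
  𝟙-yes (no ¬a) a = contradiction a ¬a

  𝟙-no : ∀ {A : Set} (d : Dec A) → ¬ A → 𝟙 d ≡ 0
  𝟙-no (yes a) ¬a = contradiction a ¬a
  𝟙-no (no _)  _  = refl

  𝟙-× : ∀ {A B : Set} (a : Dec A) (b : Dec B) → 𝟙 (a ×-dec b) ≡ 𝟙 a * 𝟙 b
  𝟙-× (yes _) (yes _) = refl
  𝟙-× (yes _) (no _)  = refl
  𝟙-× (no _)  _       = refl

  𝟙-¬ : ∀ {A : Set} (a : Dec A) → 𝟙 (¬? a) + 𝟙 a ≡ 1
  𝟙-¬ (yes _) = refl
  𝟙-¬ (no _)  = refl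

  sumFin≡sum : ∀ {n} (f : Fin n → ℕ) → sumFin f ≡ sum f
  sumFin≡sum {zero}  f = refl
  sumFin≡sum {suc n} f = cong (f zero +_) (sumFin≡sum (λ i → f (suc i)))

  count≡sum : ∀ {n} {P : Pred (Fin n) 0ℓ} (P? : Decidable P) → count P? ≡ sum (λ i → 𝟙 (P? i))
  count≡sum {zero}  P? = refl
  count≡sum {suc n} P? with P? zero
  ... | yes _ = cong suc (count≡sum (λ i → P? (suc i)))
  ... | no  _ = count≡sum (λ i → P? (suc i))

  sum-zero : ∀ {n} {f : Fin n → ℕ} → (∀ i → f i ≡ 0) → sum f ≡ 0
  sum-zero {n} f≡0 = trans (sum-cong-≗ f≡0) (sum-replicate-zero n)

  sum-single : ∀ {n} (f : Fin n → ℕ) j → (∀ i → i ≢ j → f i ≡ 0) → sum f ≡ f j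
  sum-single f zero    others = trans (cong (f zero +_) (sum-zero (λ i → others (suc i) (λ ())))) (+-identityʳ (f zero))
  sum-single f (suc j) others = cong₂ _+_ (others zero (λ ())) (sum-single (f ∘ suc) j (λ i i≢j → others (suc i) (i≢j ∘ suc-injective)))
    where open import Data.Fin.Properties using (suc-injective)
          open import Function using (_∘_)

  term≤sum : ∀ {n} (f : Fin n → ℕ) j → f j ≤ sum f
  term≤sum f zero    = m≤m+n (f zero) _
  term≤sum f (suc j) = ≤-trans (term≤sum (λ i → f (suc i)) j) (m≤n+m _ (f zero))

  sum-ones : ∀ n → sum {n} (λ _ → 1) ≡ n
  sum-ones zero    = refl
  sum-ones (suc n) = cong suc (sum-ones n)

module Counting {v : ℕ} (G : FiniteAbelianGroup v) (D : Subset G) where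
  open FiniteAbelianGroup G
  open import Data.Nat.Properties
    using (+-*-semiring; *-identityʳ; *-zeroʳ; module ≤-Reasoning; n≢0⇒n>0)
    renaming (_≟_ to _≟ℕ_)
  open import Data.Nat.Tactic.RingSolver using (solve; solve-∀)
  open import Data.Fin using (Fin)
  open import Data.List using ([]; _∷_)
  open import Data.Product using (Σ; _×_; _,_; proj₁; proj₂)
  open import Data.Sum using (inj₁; inj₂)
  open import Relation.Nullary using (Dec; yes; no; _×-dec_; ¬?; contradiction)
  open import Relation.Binary.PropositionalEquality as ≡ using (_≢_; cong; cong₂; module ≡-Reasoning)
  open import Algebra.Properties.Semiring.Sum +-*-semiring
    using (sum; sum-cong-≗; ∑-comm; ∑-distrib-+; *-distribˡ-sum; *-distribʳ-sum)
  open import Algebra.Properties.AbelianGroup grp using (x∙y⁻¹≈ε⇒x≈y; ε⁻¹≈ε; ⁻¹-involutive)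
  open FiniteSums

  index : Carrier → Fin v
  index y = proj₁ (enum-surj y)

  enum-index : ∀ y → enum (index y) ≈ y
  enum-index y = proj₂ (enum-surj y)

  ∑-hits : ∀ y → sum (λ x → 𝟙 (y ≟ enum x)) ≡ 1
  ∑-hits y = ≡.trans (sum-single _ (index y) elsewhere) (𝟙-yes (y ≟ _) (sym (enum-index y)))
    where
    elsewhere : ∀ x → x ≢ index y → 𝟙 (y ≟ enum x) ≡ 0
    elsewhere x x≢ = 𝟙-no (y ≟ enum x) (λ y≈x → x≢ (enum-inj x (index y) (trans (sym y≈x) (sym (enum-index y)))))

  inD : Fin v → ℕ
  inD i = 𝟙 (mem? D (enum i))

  k₀ : ℕ
  k₀ = sum inD

  distinct same : Fin v → Fin v → ℕ
  distinct i j = 𝟙 (¬? (enum i ≟ enum j))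
  same     i j = 𝟙 (enum i ≟ enum j)

  pair : Fin v → Fin v → ℕ
  pair i j = inD i * (inD j * distinct i j)

  Represents : Carrier → Fin v → Fin v → Set
  Represents y i j = mem D (enum i) × (mem D (enum j) × (¬ enum i ≈ enum j × (enum i ∙ enum j ⁻¹) ≈ y))

  represents? : ∀ y i j → Dec (Represents y i j)
  represents? y i j = mem? D (enum i) ×-dec (mem? D (enum j) ×-dec (¬? (enum i ≟ enum j) ×-dec ((enum i ∙ enum j ⁻¹) ≟ y)))

  nreps-as-sum : ∀ y → nreps G D y ≡ sum (λ i → sum (λ j → 𝟙 (represents? y i j)))
  nreps-as-sum y = ≡.trans (sumFin≡sum {v} _) (sum-cong-≗ {v} λ i → count≡sum (represents? y i))

  represents-split : ∀ y i j → 𝟙 (represents? y i j) ≡ pair i j * 𝟙 ((enum i ∙ enum j ⁻¹) ≟ y)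
  represents-split y i j = begin
    𝟙 (dᵢ ×-dec (dⱼ ×-dec (nij ×-dec hit)))  ≡⟨ 𝟙-× dᵢ _ ⟩
    𝟙 dᵢ * 𝟙 (dⱼ ×-dec (nij ×-dec hit))       ≡⟨ cong (𝟙 dᵢ *_) (≡.trans (𝟙-× dⱼ _) (cong (𝟙 dⱼ *_) (𝟙-× nij hit))) ⟩
    𝟙 dᵢ * (𝟙 dⱼ * (𝟙 nij * 𝟙 hit))          ≡⟨ regroup (𝟙 dᵢ) (𝟙 dⱼ) (𝟙 nij) (𝟙 hit) ⟩
    𝟙 dᵢ * (𝟙 dⱼ * 𝟙 nij) * 𝟙 hit            ∎
    where
    open ≡-Reasoning
    dᵢ : Dec (mem D (enum i))
    dᵢ = mem? D (enum i)
    dⱼ : Dec (mem D (enum j))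
    dⱼ = mem? D (enum j)
    nij : Dec (¬ enum i ≈ enum j)
    nij = ¬? (enum i ≟ enum j)
    hit : Dec ((enum i ∙ enum j ⁻¹) ≈ y)
    hit = (enum i ∙ enum j ⁻¹) ≟ y
    regroup : ∀ a b c d → a * (b * (c * d)) ≡ a * (b * c) * d
    regroup = solve-∀

  ∑-nreps : sum (λ x → nreps G D (enum x)) ≡ sum (λ i → sum (λ j → pair i j))
  ∑-nreps = begin
    sum (λ x → nreps G D (enum x))                              ≡⟨ sum-cong-≗ (λ x → ≡.trans (nreps-as-sum (enum x))
                                                                     (sum-cong-≗ λ i → sum-cong-≗ λ j → represents-split (enum x) i j)) ⟩
    sum (λ x → sum (λ i → sum (λ j → pair i j * hit i j x)))    ≡⟨ ∑-comm (λ x i → sum (λ j → pair i j * hit i j x)) ⟩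
    sum (λ i → sum (λ x → sum (λ j → pair i j * hit i j x)))    ≡⟨ sum-cong-≗ (λ i → ∑-comm (λ x j → pair i j * hit i j x)) ⟩
    sum (λ i → sum (λ j → sum (λ x → pair i j * hit i j x)))    ≡⟨ sum-cong-≗ (λ i → sum-cong-≗ λ j → ≡.sym (*-distribˡ-sum (pair i j) (hit i j))) ⟩
    sum (λ i → sum (λ j → pair i j * sum (hit i j)))            ≡⟨ sum-cong-≗ (λ i → sum-cong-≗ λ j →
                                                                     ≡.trans (cong (pair i j *_) (∑-hits _)) (*-identityʳ _)) ⟩
    sum (λ i → sum (λ j → pair i j))                            ∎
    where
    open ≡-Reasoning
    hit : Fin v → Fin v → Fin v → ℕ
    hit i j x = 𝟙 ((enum i ∙ enum j ⁻¹) ≟ enum x)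

  diagonal : ∀ i → sum (λ j → inD i * (inD j * same i j)) ≡ inD i
  diagonal i = ≡.trans (sum-single _ i elsewhere) at-i
    where
    elsewhere : ∀ j → j ≢ i → inD i * (inD j * same i j) ≡ 0
    elsewhere j j≢i rewrite 𝟙-no (enum i ≟ enum j) (λ gᵢ≈gⱼ → j≢i (≡.sym (enum-inj i j gᵢ≈gⱼ))) =
      ≡.trans (cong (inD i *_) (*-zeroʳ (inD j))) (*-zeroʳ (inD i))
    at-i : inD i * (inD i * same i i) ≡ inD i
    at-i with mem? D (enum i) | enum i ≟ enum i
    ... | no _  | _         = ≡.refl
    ... | yes _ | yes _     = ≡.refl
    ... | yes _ | no gᵢ≉gᵢ = contradiction refl gᵢ≉gᵢ

  -- For fixed g_i, the g_j ∈ D different from and equal to g_i together make up D.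
  row : ∀ i → sum (λ j → pair i j) + inD i ≡ inD i * k₀
  row i = begin
    sum (pair i) + inD i                                    ≡⟨ cong (sum (pair i) +_) (≡.sym (diagonal i)) ⟩
    sum (pair i) + sum (λ j → inD i * (inD j * same i j))   ≡⟨ ≡.sym (∑-distrib-+ (pair i) _) ⟩
    sum (λ j → pair i j + inD i * (inD j * same i j))       ≡⟨ sum-cong-≗ distinct-or-same ⟩
    sum (λ j → inD i * inD j)                               ≡⟨ ≡.sym (*-distribˡ-sum (inD i) inD) ⟩
    inD i * k₀                                              ∎
    where
    open ≡-Reasoning
    factor : ∀ a b x y → a * (b * x) + a * (b * y) ≡ a * (b * (x + y))
    factor = solve-∀
    distinct-or-same : ∀ j → pair i j + inD i * (inD j * same i j) ≡ inD i * inD j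
    distinct-or-same j = ≡.trans (factor (inD i) (inD j) _ _)
      (cong (λ t → inD i * t) (≡.trans (cong (inD j *_) (𝟙-¬ (enum i ≟ enum j))) (*-identityʳ (inD j))))

  pairs+k≡k² : sum (λ i → sum (λ j → pair i j)) + k₀ ≡ k₀ * k₀
  pairs+k≡k² = begin
    sum (λ i → sum (pair i)) + sum inD   ≡⟨ ≡.sym (∑-distrib-+ (λ i → sum (pair i)) inD) ⟩
    sum (λ i → sum (pair i) + inD i)     ≡⟨ sum-cong-≗ row ⟩
    sum (λ i → inD i * k₀)               ≡⟨ ≡.sym (*-distribʳ-sum k₀ inD) ⟩
    k₀ * k₀                              ∎
    where open ≡-Reasoning

  outside isId : Fin v → ℕ
  outside x = 𝟙 (¬? (mem? D (enum x)) ×-dec ¬? (ε ≟ enum x))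
  isId    x = 𝟙 (ε ≟ enum x)

  nreps-ε : ∀ y → y ≈ ε → nreps G D y ≡ 0
  nreps-ε y y≈ε = ≡.trans (nreps-as-sum y) (sum-zero λ i → sum-zero λ j → 𝟙-no (represents? y i j)
    λ (_ , _ , gᵢ≉gⱼ , gᵢgⱼ⁻¹≈y) → gᵢ≉gⱼ (x∙y⁻¹≈ε⇒x≈y _ _ (trans gᵢgⱼ⁻¹≈y y≈ε)))

  nreps-pos : ∀ {g h y} → mem D g → mem D h → ¬ g ≈ h → g ∙ h ⁻¹ ≈ y → 1 ≤ nreps G D y
  nreps-pos {g} {h} {y} g∈D h∈D g≉h gh⁻¹≈y = begin
    1                                                ≡⟨ ≡.sym (𝟙-yes (represents? y i j) witness) ⟩
    𝟙 (represents? y i j)                            ≤⟨ term≤sum _ j ⟩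
    sum (λ j′ → 𝟙 (represents? y i j′))              ≤⟨ term≤sum (λ i′ → sum (λ j′ → 𝟙 (represents? y i′ j′))) i ⟩
    sum (λ i′ → sum (λ j′ → 𝟙 (represents? y i′ j′))) ≡⟨ ≡.sym (nreps-as-sum y) ⟩
    nreps G D y                                      ∎
    where
    open ≤-Reasoning
    i j : Fin v
    i = index g
    j = index h
    witness : Represents y i j
    witness = resp D (sym (enum-index g)) g∈D , resp D (sym (enum-index h)) h∈D
            , (λ gᵢ≈gⱼ → g≉h (trans (sym (enum-index g)) (trans gᵢ≈gⱼ (enum-index h))))
            , trans (∙-cong (enum-index g) (⁻¹-cong (enum-index h))) gh⁻¹≈y

  module _ {k lam mu : ℕ} (pds : IsPDS G D k lam mu) (reg : IsRegular G D) where
    open IsPDS pds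
    open IsRegular reg

    nreps-value : ∀ x → nreps G D (enum x) ≡ lam * inD x + mu * outside x
    nreps-value x with mem? D (enum x) | ε ≟ enum x
    ... | yes x∈D | _      = ≡.trans (onD _ (λ x≈ε → no-id (resp D x≈ε x∈D)) x∈D) (solve (lam ∷ mu ∷ []))
    ... | no x∉D  | no x≉ε = ≡.trans (offD _ (λ x≈ε → x≉ε (sym x≈ε)) x∉D) (solve (lam ∷ mu ∷ []))
    ... | no _    | yes ε≈x = ≡.trans (nreps-ε _ (sym ε≈x)) (solve (lam ∷ mu ∷ []))

    partition : ∀ x → outside x + inD x + isId x ≡ 1
    partition x with mem? D (enum x) | ε ≟ enum x
    ... | yes x∈D | yes ε≈x = contradiction (resp D (sym ε≈x) x∈D) no-id
    ... | yes _   | no _    = ≡.refl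
    ... | no _    | yes _   = ≡.refl
    ... | no _    | no _    = ≡.refl

    k≡k₀ : k ≡ k₀
    k≡k₀ = ≡.trans (≡.sym size-D) (count≡sum {v} (λ i → mem? D (enum i)))

    -- The two standard counting identities of a regular (v,k,λ,μ)-PDS, where c is
    -- the number of non-identity elements outside D.
    pds-counting : Σ ℕ λ c → (lam * k + mu * c + k ≡ k * k) × (c + k + 1 ≡ v)
    pds-counting rewrite k≡k₀ = c , count-pairs , count-elements
      where
      open ≡-Reasoning
      c : ℕ
      c = sum outside
      count-pairs : lam * k₀ + mu * c + k₀ ≡ k₀ * k₀
      count-pairs = begin
        lam * k₀ + mu * c + k₀                                ≡⟨ cong (_+ k₀) (cong₂ _+_ (*-distribˡ-sum lam inD) (*-distribˡ-sum mu outside)) ⟩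
        sum (λ x → lam * inD x) + sum (λ x → mu * outside x) + k₀ ≡⟨ cong (_+ k₀) (≡.sym (∑-distrib-+ (λ x → lam * inD x) (λ x → mu * outside x))) ⟩
        sum (λ x → lam * inD x + mu * outside x) + k₀         ≡⟨ cong (_+ k₀) (≡.sym (sum-cong-≗ nreps-value)) ⟩
        sum (λ x → nreps G D (enum x)) + k₀                   ≡⟨ cong (_+ k₀) ∑-nreps ⟩
        sum (λ i → sum (λ j → pair i j)) + k₀                 ≡⟨ pairs+k≡k² ⟩
        k₀ * k₀                                               ∎
      count-elements : c + k₀ + 1 ≡ v
      count-elements = begin
        sum outside + sum inD + 1                             ≡⟨ cong (sum outside + sum inD +_) (≡.sym (∑-hits ε)) ⟩
        sum outside + sum inD + sum isId                      ≡⟨ cong (_+ sum isId) (≡.sym (∑-distrib-+ outside inD)) ⟩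
        sum (λ x → outside x + inD x) + sum isId              ≡⟨ ≡.sym (∑-distrib-+ (λ x → outside x + inD x) isId) ⟩
        sum (λ x → outside x + inD x + isId x)                ≡⟨ sum-cong-≗ partition ⟩
        sum {v} (λ _ → 1)                                     ≡⟨ sum-ones v ⟩
        v                                                     ∎

    μ≡0⇒subgroup : mu ≡ 0 → IsSubgroup G (withId G D)
    μ≡0⇒subgroup mu≡0 = record { has-ε = inj₂ refl ; ∙-cl = closed ; ⁻¹-cl = inverses }
      where
      withId-resp : ∀ {x y} → x ≈ y → withId G D x → withId G D y
      withId-resp x≈y (inj₁ x∈D) = inj₁ (resp D x≈y x∈D)
      withId-resp x≈y (inj₂ x≈ε) = inj₂ (trans (sym x≈y) x≈ε)
      inverses : ∀ x → withId G D x → withId G D (x ⁻¹)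
      inverses x (inj₁ x∈D) = inj₁ (inv-closed x x∈D)
      inverses x (inj₂ x≈ε) = inj₂ (trans (⁻¹-cong x≈ε) ε⁻¹≈ε)
      -- a product xy ∉ D ∪ {e} of x, y ∈ D would be represented by the pair (x , y⁻¹)
      product : ∀ x y → mem D x → mem D y → withId G D (x ∙ y)
      product x y x∈D y∈D with mem? D (x ∙ y) | (x ∙ y) ≟ ε
      ... | yes xy∈D | _       = inj₁ xy∈D
      ... | no _     | yes xy≈ε = inj₂ xy≈ε
      ... | no xy∉D  | no xy≉ε  = contradiction (≡.subst (1 ≤_) (≡.trans (offD _ xy≉ε xy∉D) mu≡0) represented) (λ ())
        where
        represented : 1 ≤ nreps G D (x ∙ y)
        represented = nreps-pos x∈D (inv-closed y y∈D)
          (λ x≈y⁻¹ → xy≉ε (trans (∙-congʳ x≈y⁻¹) (inverseˡ y))) (∙-congˡ (⁻¹-involutive y))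
      closed : ∀ x y → withId G D x → withId G D y → withId G D (x ∙ y)
      closed x y (inj₂ x≈ε) y∈ = withId-resp (sym (trans (∙-congʳ x≈ε) (identityˡ y))) y∈
      closed x y (inj₁ x∈D) (inj₂ y≈ε) = inj₁ (resp D (sym (trans (∙-congˡ y≈ε) (identityʳ x))) x∈D)
      closed x y (inj₁ x∈D) (inj₁ y∈D) = product x y x∈D y∈D

    nontrivial⇒μ≥1 : ¬ IsTrivial G D → 1 ≤ mu
    nontrivial⇒μ≥1 nontrivial with mu ≟ℕ 0
    ... | yes mu≡0 = contradiction (inj₁ (μ≡0⇒subgroup mu≡0)) nontrivial
    ... | no mu≢0  = n≢0⇒n>0 mu≢0

module Discriminant where
  open import Data.Integer as ℤ using (ℤ; +_)
  open import Data.Integer.Properties using (pos-*; +-injective)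
  open import Data.Integer.Tactic.RingSolver using (solve-∀)
  open import Relation.Binary.PropositionalEquality using (trans; cong; cong₂; module ≡-Reasoning)

  Δ-in-ℕ : ∀ {k lam mu D} →
           (+ lam ℤ.- + mu) ℤ.* (+ lam ℤ.- + mu) ℤ.+ (+ 4) ℤ.* (+ k ℤ.- + mu) ≡ + D →
           lam * lam + mu * mu + 4 * k ≡ D + (2 * (lam * mu) + 4 * mu)
  Δ-in-ℕ {k} {lam} {mu} {D} Δ≡D = +-injective (begin
    + (lam * lam + mu * mu + 4 * k)                                  ≡⟨ cong₂ ℤ._+_ (cong₂ ℤ._+_ (pos-* lam lam) (pos-* mu mu)) (pos-* 4 k) ⟩
    L ℤ.* L ℤ.+ M ℤ.* M ℤ.+ + 4 ℤ.* K                                ≡⟨ expand L M K ⟩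
    ((L ℤ.- M) ℤ.* (L ℤ.- M) ℤ.+ + 4 ℤ.* (K ℤ.- M)) ℤ.+ (+ 2 ℤ.* (L ℤ.* M) ℤ.+ + 4 ℤ.* M)
                                                                     ≡⟨ cong (ℤ._+ (+ 2 ℤ.* (L ℤ.* M) ℤ.+ + 4 ℤ.* M)) Δ≡D ⟩
    + D ℤ.+ (+ 2 ℤ.* (L ℤ.* M) ℤ.+ + 4 ℤ.* M)                        ≡⟨ cong (λ x → + D ℤ.+ x) (cong₂ ℤ._+_ (trans (pos-* 2 (lam * mu)) (cong (+ 2 ℤ.*_) (pos-* lam mu))) (pos-* 4 mu)) ⟨
    + (D + (2 * (lam * mu) + 4 * mu))                                ∎)
    where
    open ≡-Reasoning
    L M K : ℤ
    L = + lam
    M = + mu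
    K = + k
    expand : ∀ l m k → l ℤ.* l ℤ.+ m ℤ.* m ℤ.+ + 4 ℤ.* k ≡ ((l ℤ.- m) ℤ.* (l ℤ.- m) ℤ.+ + 4 ℤ.* (k ℤ.- m)) ℤ.+ (+ 2 ℤ.* (l ℤ.* m) ℤ.+ + 4 ℤ.* m)
    expand = solve-∀

module ParameterArithmetic where
  open import Data.Nat using (zero; suc; _<_; z≤n; s≤s; s≤s⁻¹; >-nonZero)
  open import Data.Nat.Properties
  open import Data.Nat.Tactic.RingSolver using (solve)
  open import Data.List using ([]; _∷_)
  open import Data.Product using (_,_)
  open import Data.Sum using (inj₁; inj₂)
  open import Relation.Nullary using (contradiction)
  open import Relation.Binary.PropositionalEquality using (refl; sym; trans; cong; cong₂; subst; module ≡-Reasoning)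

  two-mul≤squares : ∀ a b → 2 * (a * b) ≤ a * a + b * b
  two-mul≤squares a b with ≤-total a b
  ... | inj₁ a≤b with m≤n⇒∃[o]m+o≡n a≤b
  ...   | d , refl = ≤-trans (m≤m+n _ (d * d)) (≤-reflexive (solve (a ∷ d ∷ [])))
  two-mul≤squares a b | inj₂ b≤a with m≤n⇒∃[o]m+o≡n b≤a
  ...   | d , refl = ≤-trans (m≤m+n _ (d * d)) (≤-reflexive (solve (b ∷ d ∷ [])))

  -- In the lemmas below, lam * k + mu * c + k ≡ k * k and c + k + 1 ≡ v are the counting
  -- identities of a (v,k,λ,μ)-PDS, c being the number of non-identity elements outside D.

  μc≡0⇒c≡0 : ∀ {mu c} → 1 ≤ mu → mu * c ≡ 0 → c ≡ 0
  μc≡0⇒c≡0 {suc m} _ μc≡0 with m*n≡0⇒m≡0∨n≡0 (suc m) μc≡0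
  ... | inj₂ c≡0 = c≡0

  -- |D| ≥ 2: otherwise μ c = 0, so c = 0 and v = k + 1 ≤ 2.
  2≤k : ∀ {v k lam mu c} → lam * k + mu * c + k ≡ k * k → c + k + 1 ≡ v → 3 ≤ v → 1 ≤ mu → 2 ≤ k
  2≤k {k = suc (suc _)} _ _ _ _ = s≤s (s≤s z≤n)
  2≤k {k = 0} {lam} {mu} {c} pairs elements 3≤v 1≤μ =
    contradiction (subst (λ x → 3 ≤ x + 0 + 1) c≡0 (subst (3 ≤_) (sym elements) 3≤v)) λ { (s≤s ()) }
    where
    c≡0 : c ≡ 0
    c≡0 = μc≡0⇒c≡0 1≤μ (m+n≡0⇒n≡0 (lam * 0) (trans (sym (+-identityʳ _)) pairs))
  2≤k {k = 1} {lam} {mu} {c} pairs elements 3≤v 1≤μ =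
    contradiction (subst (λ x → 3 ≤ x + 1 + 1) c≡0 (subst (3 ≤_) (sym elements) 3≤v)) λ { (s≤s (s≤s ())) }
    where
    c≡0 : c ≡ 0
    c≡0 = μc≡0⇒c≡0 1≤μ (m+n≡0⇒n≡0 (lam * 1) (+-cancelʳ-≡ 1 _ 0 pairs))

  -- λ < k, from (λ + 1) k ≤ λ k + μ c + k = k².
  λ<k : ∀ {v k lam mu c} → lam * k + mu * c + k ≡ k * k → c + k + 1 ≡ v → 3 ≤ v → 1 ≤ mu → lam < k
  λ<k {v} {k} {lam} {mu} {c} pairs elements 3≤v 1≤μ =
    *-cancelʳ-≤ (suc lam) k k {{>-nonZero (<⇒≤ (2≤k {v} {k} {lam} {mu} {c} pairs elements 3≤v 1≤μ))}} (begin
      suc lam * k            ≡⟨ +-comm k (lam * k) ⟩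
      lam * k + k            ≤⟨ +-monoˡ-≤ k (m≤m+n (lam * k) (mu * c)) ⟩
      lam * k + mu * c + k   ≡⟨ pairs ⟩
      k * k                  ∎)
    where open ≤-Reasoning

  -- μ ≤ k when 2k ≤ v: writing k = k′ + 1 we have k′ ≤ c, and μ k′ ≤ μ c ≤ k² − k = k k′.
  μ≤k : ∀ {v k lam mu c} → lam * k + mu * c + k ≡ k * k → c + k + 1 ≡ v → 3 ≤ v → 1 ≤ mu → 2 * k ≤ v → mu ≤ k
  μ≤k {v} {zero} {lam} {mu} {c} pairs elements 3≤v 1≤μ _ =
    contradiction (2≤k {v} {zero} {lam} {mu} {c} pairs elements 3≤v 1≤μ) λ ()
  μ≤k {v} {suc k′} {lam} {mu} {c} pairs elements 3≤v 1≤μ 2k≤v =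
    *-cancelʳ-≤ mu (suc k′) k′ {{>-nonZero (s≤s⁻¹ (2≤k {v} {suc k′} {lam} {mu} {c} pairs elements 3≤v 1≤μ))}} (begin
      mu * k′                       ≤⟨ *-monoʳ-≤ mu k′≤c ⟩
      mu * c                        ≤⟨ +-cancelʳ-≤ (suc k′) _ _ (begin
        mu * c + suc k′                   ≤⟨ +-monoˡ-≤ (suc k′) (m≤n+m (mu * c) (lam * suc k′)) ⟩
        lam * suc k′ + mu * c + suc k′    ≡⟨ pairs ⟩
        suc k′ * suc k′                   ≡⟨ solve (k′ ∷ []) ⟩
        suc k′ * k′ + suc k′              ∎) ⟩
      suc k′ * k′                   ∎)
    where
    open ≤-Reasoning
    k′≤c : k′ ≤ c
    k′≤c = +-cancelˡ-≤ (suc k′) k′ c (≤-pred (begin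
      suc (suc k′ + k′)       ≡⟨ solve (k′ ∷ []) ⟩
      2 * suc k′              ≤⟨ 2k≤v ⟩
      v                       ≡⟨ sym elements ⟩
      c + suc k′ + 1          ≡⟨ solve (c ∷ k′ ∷ []) ⟩
      suc (suc k′ + c)        ∎))

  -- Let t = 2k + μ − λ; in terms of the eigenvalues r, s of the PDS, t = (k − r) + (k − s).
  -- Given Δ = (λ − μ)² + 4(k − μ) = δ², the identity (k − r)(k − s) = vμ becomes
  -- t² = δ² + 4vμ.
  gap-square : ∀ {v k lam mu c δ t} → lam * k + mu * c + k ≡ k * k → c + k + 1 ≡ v →
               lam * lam + mu * mu + 4 * k ≡ δ * δ + (2 * (lam * mu) + 4 * mu) →
               t + lam ≡ 2 * k + mu → t * t ≡ δ * δ + 4 * v * mu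
  gap-square {v} {k} {lam} {mu} {c} {δ} {t} pairs elements Δ≡δ² t+λ = +-cancelʳ-≡ S _ _ (begin
    t * t + S                                                ≡⟨ cong (λ x → t * t + (2 * lam * x + 4 * k)) (sym t+λ) ⟩
    t * t + (2 * lam * (t + lam) + 4 * k)                    ≡⟨ solve (t ∷ lam ∷ k ∷ []) ⟩
    (t + lam) * (t + lam) + (lam * lam + 4 * k)              ≡⟨ cong (λ x → x * x + (lam * lam + 4 * k)) t+λ ⟩
    (2 * k + mu) * (2 * k + mu) + (lam * lam + 4 * k)        ≡⟨ solve (k ∷ mu ∷ lam ∷ []) ⟩
    4 * (k * k) + 4 * k * mu + (lam * lam + mu * mu + 4 * k) ≡⟨ cong₂ (λ x y → 4 * x + 4 * k * mu + y) (sym pairs) Δ≡δ² ⟩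
    4 * (lam * k + mu * c + k) + 4 * k * mu + (δ * δ + (2 * (lam * mu) + 4 * mu))
                                                             ≡⟨ solve (lam ∷ k ∷ mu ∷ c ∷ δ ∷ []) ⟩
    δ * δ + 4 * (c + k + 1) * mu + (2 * lam * (2 * k + mu) + 4 * k)
                                                             ≡⟨ cong (λ x → δ * δ + 4 * x * mu + S) elements ⟩
    δ * δ + 4 * v * mu + S                                   ∎)
    where
    open ≡-Reasoning
    S : ℕ
    S = 2 * lam * (2 * k + mu) + 4 * k

  -- The same data bound t linearly: 2t = 4μ + (δ − 1)² − (λ − μ + 1)² ≤ 4μ + δ² + 1.
  gap-bound : ∀ {k lam mu δ t} → lam * lam + mu * mu + 4 * k ≡ δ * δ + (2 * (lam * mu) + 4 * mu) →
              t + lam ≡ 2 * k + mu → 2 * t ≤ 4 * mu + δ * δ + 1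
  gap-bound {k} {lam} {mu} {δ} {t} Δ≡δ² t+λ = +-cancelʳ-≤ (2 * (suc lam * mu)) _ _ (begin
    2 * t + 2 * (suc lam * mu)                         ≤⟨ +-monoʳ-≤ (2 * t) (two-mul≤squares (suc lam) mu) ⟩
    2 * t + (suc lam * suc lam + mu * mu)              ≡⟨ solve (t ∷ lam ∷ mu ∷ []) ⟩
    2 * (t + lam) + (lam * lam + mu * mu + 1)          ≡⟨ cong (λ x → 2 * x + (lam * lam + mu * mu + 1)) t+λ ⟩
    2 * (2 * k + mu) + (lam * lam + mu * mu + 1)       ≡⟨ solve (k ∷ mu ∷ lam ∷ []) ⟩
    (lam * lam + mu * mu + 4 * k) + 2 * mu + 1         ≡⟨ cong (λ x → x + 2 * mu + 1) Δ≡δ² ⟩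
    δ * δ + (2 * (lam * mu) + 4 * mu) + 2 * mu + 1     ≡⟨ solve (δ ∷ lam ∷ mu ∷ []) ⟩
    4 * mu + δ * δ + 1 + 2 * (suc lam * mu)            ∎)
    where open ≤-Reasoning

  gap-quadratic : ∀ {v mu δ t} → t * t ≡ δ * δ + 4 * v * mu → 2 * t ≤ 4 * mu + δ * δ + 1 →
                  2 * v * t + δ * δ ≤ t * t + v * (δ * δ + 1)
  gap-quadratic {v} {mu} {δ} {t} t²≡ 2t≤ = begin
    2 * v * t + δ * δ                     ≡⟨ solve (v ∷ t ∷ δ ∷ []) ⟩
    v * (2 * t) + δ * δ                   ≤⟨ +-monoˡ-≤ (δ * δ) (*-monoʳ-≤ v 2t≤) ⟩
    v * (4 * mu + δ * δ + 1) + δ * δ      ≡⟨ solve (v ∷ mu ∷ δ ∷ []) ⟩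
    δ * δ + 4 * v * mu + v * (δ * δ + 1)  ≡⟨ cong (_+ v * (δ * δ + 1)) (sym t²≡) ⟩
    t * t + v * (δ * δ + 1)               ∎
    where open ≤-Reasoning

  -- On the interval [L , W − L] the parabola t ↦ t (W − t) is bounded below by its value at L:
  -- writing W = t + b with b ≥ L, we have L (t + b) ≤ t b + L².
  parabola-gap : ∀ {L t W A B} → L ≤ t → t + L ≤ W → W * t + A ≤ t * t + B → W * L + A ≤ L * L + B
  parabola-gap {L} {t} {W} {A} {B} L≤t t+L≤W Wt+A≤t²+B with m≤n⇒∃[o]m+o≡n L≤t | m≤n⇒∃[o]m+o≡n t+L≤W
  ... | e , refl | f , refl = begin
    (L + e + L + f) * L + A             ≤⟨ m≤m+n _ (e * f) ⟩
    (L + e + L + f) * L + A + e * f     ≡⟨ solve (L ∷ e ∷ f ∷ A ∷ []) ⟩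
    L * L + ((L + e) * (L + f) + A)     ≤⟨ +-monoʳ-≤ (L * L) tb+A≤B ⟩
    L * L + B                           ∎
    where
    open ≤-Reasoning
    tb+A≤B : (L + e) * (L + f) + A ≤ B
    tb+A≤B = +-cancelˡ-≤ ((L + e) * (L + e)) _ _ (begin
      (L + e) * (L + e) + ((L + e) * (L + f) + A)   ≡⟨ solve (L ∷ e ∷ f ∷ A ∷ []) ⟩
      (L + e + L + f) * (L + e) + A                 ≤⟨ Wt+A≤t²+B ⟩
      (L + e) * (L + e) + B                         ∎)

  square-shift : ∀ δ n X → (δ + n) * (δ + n) ≡ δ * δ + X → n * (n + 2 * δ) ≡ X
  square-shift δ n X eq = +-cancelˡ-≡ (δ * δ) _ _ (begin
    δ * δ + n * (n + 2 * δ)   ≡⟨ solve (δ ∷ n ∷ []) ⟩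
    (δ + n) * (δ + n)         ≡⟨ eq ⟩
    δ * δ + X                 ∎)
    where open ≡-Reasoning

  square-≥ : ∀ δ t X → t * t ≡ δ * δ + X → δ ≤ t
  square-≥ δ t X eq = ≮⇒≥ λ t<δ → <⇒≱ (*-mono-< t<δ t<δ) (≤-trans (m≤m+n (δ * δ) X) (≤-reflexive (sym eq)))

module NumberTheory where
  open import Data.Nat using (_<_; z≤n; s≤s; NonZero)
  open import Data.Nat.Properties
  open import Data.Nat.Divisibility using (_∣_; divides; ∣m+n∣m⇒∣n; ∣⇒≤)
  open import Data.Nat.Primality using (euclidsLemma; prime[2]; prime⇒nonZero)
  open import Data.Nat.Tactic.RingSolver using (solve; solve-∀)
  open import Data.List using ([]; _∷_)
  open import Data.Product using (_×_; _,_; ∃)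
  open import Data.Sum using (inj₁; inj₂; [_,_]′)
  open import Relation.Nullary using (contradiction)
  open import Relation.Binary.PropositionalEquality using (refl; sym; trans; cong; subst; module ≡-Reasoning)

  even-factor : ∀ a c b → a * (a + 2 * c) ≡ 2 * b → 2 ∣ a
  even-factor a c b a[a+2c]≡2b with euclidsLemma a (a + 2 * c) prime[2] (divides b (trans a[a+2c]≡2b (*-comm 2 b)))
  ... | inj₁ 2∣a    = 2∣a
  ... | inj₂ 2∣a+2c = ∣m+n∣m⇒∣n (subst (2 ∣_) (+-comm a (2 * c)) 2∣a+2c) (divides c (*-comm 2 c))

  halve : ∀ a c b → a * (a + 2 * c) ≡ 2 * b → ∃ λ h → a ≡ 2 * h × 2 * (h * (h + c)) ≡ b
  halve a c b a[a+2c]≡2b with even-factor a c b a[a+2c]≡2b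
  ... | divides h refl = h , *-comm h 2 , *-cancelˡ-≡ _ _ 2 (begin
    2 * (2 * (h * (h + c)))           ≡⟨ solve (h ∷ c ∷ []) ⟩
    h * 2 * (h * 2 + 2 * c)           ≡⟨ a[a+2c]≡2b ⟩
    2 * b                             ∎)
    where open ≡-Reasoning

  eighth : ∀ U x → U * (U + 8) ≡ 32 * x → ∃ λ R → U ≡ 8 * R × 2 * (R * (R + 1)) ≡ x
  eighth U x U[U+8]≡32x =
    let W , U≡2W , e₁ = halve U 4 (16 * x) (trans U[U+8]≡32x (e32 x))
        Z , W≡2Z , e₂ = halve W 2 (4 * x) (*-cancelˡ-≡ _ _ 2 (trans e₁ (e16 x)))
        R , Z≡2R , e₃ = halve Z 1 x (*-cancelˡ-≡ _ _ 2 (trans e₂ (e4 x)))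
    in R , trans U≡2W (trans (cong (2 *_) (trans W≡2Z (cong (2 *_) Z≡2R))) (e8 R)) , e₃
    where
    e32 : ∀ y → 32 * y ≡ 2 * (16 * y)
    e32 = solve-∀
    e16 : ∀ y → 16 * y ≡ 2 * (2 * (4 * y))
    e16 = solve-∀
    e4 : ∀ y → 4 * y ≡ 2 * (2 * y)
    e4 = solve-∀
    e8 : ∀ y → 2 * (2 * (2 * y)) ≡ 8 * y
    e8 = solve-∀

  multiple-below-double : ∀ {p x} .{{_ : NonZero p}} → p ∣ x → x < 2 * p → x ≡ 0 ⊎ x ≡ p
  multiple-below-double {p} (divides q refl) qp<2p with *-cancelʳ-< p q 2 qp<2p
  ... | s≤s z≤n        = inj₁ refl
  ... | s≤s (s≤s z≤n)  = inj₂ (+-identityʳ p)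

  consecutive-product : ∀ {p R mu} → Prime p → 5 ≤ p → 1 ≤ mu → 8 * R < 10 * p →
                        2 * (R * (R + 1)) ≡ p * mu → mu ≡ 2 * p + 2 ⊎ mu ≡ 2 * p ∸ 2
  consecutive-product {p} {R} {mu} p-prime 5≤p 1≤μ 8R<10p 2R[R+1]≡pμ = [ via-R , via-R+1 ]′ p∣R⊎p∣R+1
    where
    instance
      p≢0 : NonZero p
      p≢0 = prime⇒nonZero p-prime

    open ≤-Reasoning

    double-product : ∀ x → 2 * (x * (x + 1)) ≡ x * (2 * x + 2)
    double-product = solve-∀
    double-product′ : ∀ x → 2 * (x * (x + 1)) ≡ (x + 1) * (2 * x)
    double-product′ = solve-∀

    -- p divides R(R + 1) but not 2
    p∣R⊎p∣R+1 : p ∣ R ⊎ p ∣ R + 1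
    p∣R⊎p∣R+1 with euclidsLemma 2 (R * (R + 1)) p-prime (divides mu (trans 2R[R+1]≡pμ (*-comm p mu)))
    ... | inj₁ p∣2        = contradiction (≤-trans 5≤p (∣⇒≤ p∣2)) λ { (s≤s (s≤s ())) }
    ... | inj₂ p∣R[R+1]   = euclidsLemma R (R + 1) p-prime p∣R[R+1]

    R<2p : R < 2 * p
    R<2p = *-cancelˡ-< 8 R (2 * p) (begin-strict
      8 * R         <⟨ 8R<10p ⟩
      10 * p        ≤⟨ *-monoˡ-≤ p (m≤m+n 10 6) ⟩
      16 * p        ≡⟨ *-assoc 8 2 p ⟩
      8 * (2 * p)   ∎)

    R+1<2p : R + 1 < 2 * p
    R+1<2p = *-cancelˡ-< 8 (R + 1) (2 * p) (begin-strict
      8 * (R + 1)     ≡⟨ *-distribˡ-+ 8 R 1 ⟩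
      8 * R + 8       <⟨ +-monoˡ-< 8 8R<10p ⟩
      10 * p + 8      ≤⟨ +-monoʳ-≤ (10 * p) (≤-trans (m≤m+n 8 22) (*-monoʳ-≤ 6 5≤p)) ⟩
      10 * p + 6 * p  ≡⟨ sym (*-distribʳ-+ p 10 6) ⟩
      16 * p          ≡⟨ *-assoc 8 2 p ⟩
      8 * (2 * p)     ∎)

    via-R : p ∣ R → mu ≡ 2 * p + 2 ⊎ mu ≡ 2 * p ∸ 2
    via-R p∣R with multiple-below-double p∣R R<2p
    ... | inj₁ R≡0 = contradiction (subst (1 ≤_) μ≡0 1≤μ) λ ()
      where
      μ≡0 : mu ≡ 0
      μ≡0 = m*n≡0⇒m≡0 mu p (trans (*-comm mu p) (trans (sym 2R[R+1]≡pμ) (cong (λ r → 2 * (r * (r + 1))) R≡0)))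
    ... | inj₂ R≡p = inj₁ (*-cancelˡ-≡ mu (2 * p + 2) p (begin-equality
      p * mu                  ≡⟨ sym 2R[R+1]≡pμ ⟩
      2 * (R * (R + 1))       ≡⟨ cong (λ r → 2 * (r * (r + 1))) R≡p ⟩
      2 * (p * (p + 1))       ≡⟨ double-product p ⟩
      p * (2 * p + 2)         ∎))

    via-R+1 : p ∣ R + 1 → mu ≡ 2 * p + 2 ⊎ mu ≡ 2 * p ∸ 2
    via-R+1 p∣R+1 with multiple-below-double p∣R+1 R+1<2p
    ... | inj₁ R+1≡0 = contradiction (trans (+-comm 1 R) R+1≡0) λ ()
    ... | inj₂ R+1≡p = inj₂ (begin-equality
      mu                      ≡⟨ *-cancelˡ-≡ mu (2 * R) p (begin-equality
        p * mu                    ≡⟨ sym 2R[R+1]≡pμ ⟩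
        2 * (R * (R + 1))         ≡⟨ double-product′ R ⟩
        (R + 1) * (2 * R)         ≡⟨ cong (_* (2 * R)) R+1≡p ⟩
        p * (2 * R)               ∎) ⟩
      2 * R                   ≡⟨ sym (m+n∸n≡m (2 * R) 2) ⟩
      2 * R + 2 ∸ 2           ≡⟨ cong (_∸ 2) (sym (*-distribˡ-+ 2 R 1)) ⟩
      2 * (R + 1) ∸ 2         ≡⟨ cong (λ r → 2 * r ∸ 2) R+1≡p ⟩
      2 * p ∸ 2               ∎)

module EightPCubed where
  open import Data.Nat using (_<_; z≤n; s≤s; NonZero; >-nonZero)
  open import Data.Nat.Properties
  open import Data.Nat.Divisibility using (_∣_; divides; ∣m+n∣m⇒∣n)
  open import Data.Nat.Primality using (euclidsLemma; prime⇒nonZero)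
  open import Data.Nat.Tactic.RingSolver using (solve; solve-∀)
  open import Data.List using ([]; _∷_)
  open import Data.Product using (_,_; ∃; proj₁; proj₂)
  open import Data.Sum using ([_,_]′)
  open import Relation.Binary.PropositionalEquality using (refl; sym; trans; cong; subst)
  open ParameterArithmetic
  open NumberTheory

  32p²>100p+8 : ∀ {p} → 5 ≤ p → 100 * p + 8 < 32 * (p * p)
  32p²>100p+8 5≤p with m≤n⇒∃[o]m+o≡n 5≤p
  ... | w , refl = ≤-trans (m≤m+n _ (291 + 220 * w + 32 * (w * w))) (≤-reflexive (expand w))
    where
    expand : ∀ x → 1 + (100 * (5 + x) + 8) + (291 + 220 * x + 32 * (x * x)) ≡ 32 * ((5 + x) * (5 + x))
    expand = solve-∀

  -- For p ≥ 5, the value of the parabola at L = 10p² exceeds the bound allowed by the gap: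
  -- with v = 8p³ and δ = 4p,  L² + v(δ² + 1) < 2vL + δ².
  parabola-too-high : ∀ {p} → 5 ≤ p →
    10 * p ^ 2 * (10 * p ^ 2) + 8 * p ^ 3 * (4 * p * (4 * p) + 1) < 2 * (8 * p ^ 3) * (10 * p ^ 2) + 4 * p * (4 * p)
  parabola-too-high {p} 5≤p = begin-strict
    10 * (p * (p * 1)) * (10 * (p * (p * 1))) + 8 * (p * (p * (p * 1))) * (4 * p * (4 * p) + 1) ≡⟨ solve (p ∷ []) ⟩
    (p * (p * (p * 1))) * (128 * (p * p) + (100 * p + 8))                 <⟨ *-monoʳ-< (p ^ 3) (+-monoʳ-< (128 * (p * p)) (32p²>100p+8 5≤p)) ⟩
    (p * (p * (p * 1))) * (128 * (p * p) + 32 * (p * p))                  ≡⟨ solve (p ∷ []) ⟩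
    2 * (8 * (p * (p * (p * 1)))) * (10 * (p * (p * 1)))                             ≤⟨ m≤m+n _ (4 * p * (4 * p)) ⟩
    2 * (8 * (p * (p * (p * 1)))) * (10 * (p * (p * 1))) + 4 * p * (4 * p)           ∎
    where
    open ≤-Reasoning
    instance
      p³≢0 : NonZero (p ^ 3)
      p³≢0 = m^n≢0 p 3 {{>-nonZero (≤-trans (s≤s z≤n) 5≤p)}}

  room : ∀ {p t} → 5 ≤ p → 2 * t ≤ 3 * (8 * p ^ 3) → t + 10 * p ^ 2 ≤ 2 * (8 * p ^ 3)
  room {p} {t} 5≤p 2t≤3v with m≤n⇒∃[o]m+o≡n 5≤p
  ... | w , refl = *-cancelˡ-≤ 2 (begin
    2 * (t + 10 * p ^ 2)                          ≡⟨ *-distribˡ-+ 2 t (10 * p ^ 2) ⟩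
    2 * t + 2 * (10 * p ^ 2)                      ≤⟨ +-monoˡ-≤ (2 * (10 * p ^ 2)) 2t≤3v ⟩
    3 * (8 * p ^ 3) + 2 * (10 * p ^ 2)            ≤⟨ m≤m+n _ _ ⟩
    3 * (8 * p ^ 3) + 2 * (10 * p ^ 2) + (20 + 8 * w) * p ^ 2 ≡⟨ expand ⟩
    2 * (2 * (8 * p ^ 3))                         ∎)
    where
    open ≤-Reasoning
    expand : 3 * (8 * ((5 + w) * ((5 + w) * ((5 + w) * 1)))) + 2 * (10 * ((5 + w) * ((5 + w) * 1))) + (20 + 8 * w) * ((5 + w) * ((5 + w) * 1)) ≡ 2 * (2 * (8 * ((5 + w) * ((5 + w) * ((5 + w) * 1)))))
    expand = solve (w ∷ [])

  -- n(n + 8p) = 32p³μ with n < 10p², for a prime p ≥ 5 and μ ≥ 1, forces μ = 2p ± 2: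
  -- p divides n, n = Up with U(U + 8) = 32pμ, so U = 8R with 2R(R + 1) = pμ and 8R < 10p.
  small-root : ∀ {p n mu} → Prime p → 5 ≤ p → 1 ≤ mu →
               n * (n + 2 * (4 * p)) ≡ 4 * (8 * p ^ 3) * mu → n < 10 * p ^ 2 →
               mu ≡ 2 * p + 2 ⊎ mu ≡ 2 * p ∸ 2
  small-root {p} {n} {mu} p-prime 5≤p 1≤μ n[n+8p]≡ n<10p² = via-quotient p∣n
    where
    instance
      p≢0 : NonZero p
      p≢0 = prime⇒nonZero p-prime
      p²≢0 : NonZero (p * p)
      p²≢0 = m*n≢0 p p

    open ≤-Reasoning

    factor-p : ∀ x y → 4 * (8 * (x * (x * (x * 1)))) * y ≡ 32 * (x * x) * y * x
    factor-p = solve-∀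

    eight-p : ∀ x → 2 * (4 * x) ≡ 8 * x
    eight-p = solve-∀

    regroup₁ : ∀ U x → U * (U + 8) * (x * x) ≡ (U * x) * (U * x + 2 * (4 * x))
    regroup₁ = solve-∀

    regroup₂ : ∀ x y → 4 * (8 * (x * (x * (x * 1)))) * y ≡ 32 * (x * y) * (x * x)
    regroup₂ = solve-∀

    regroup₃ : ∀ x → 10 * (x * (x * 1)) ≡ 10 * x * x
    regroup₃ = solve-∀

    p∣n : p ∣ n
    p∣n = [ (λ p∣n → p∣n) , (λ p∣n+8p → ∣m+n∣m⇒∣n (subst (p ∣_) (+-comm n (2 * (4 * p))) p∣n+8p) (divides 8 (eight-p p))) ]′
      (euclidsLemma n (n + 2 * (4 * p)) p-prime (divides (32 * (p * p) * mu) (trans n[n+8p]≡ (factor-p p mu))))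

    quotient-equation : ∀ U → n ≡ U * p → U * (U + 8) ≡ 32 * (p * mu)
    quotient-equation U n≡Up = *-cancelʳ-≡ _ _ (p * p) (begin-equality
      U * (U + 8) * (p * p)                    ≡⟨ regroup₁ U p ⟩
      (U * p) * (U * p + 2 * (4 * p))          ≡⟨ cong (λ x → x * (x + 2 * (4 * p))) (sym n≡Up) ⟩
      n * (n + 2 * (4 * p))                    ≡⟨ n[n+8p]≡ ⟩
      4 * (8 * (p * (p * (p * 1)))) * mu        ≡⟨ regroup₂ p mu ⟩
      32 * (p * mu) * (p * p)                  ∎)

    8R<10p : ∀ U R → n ≡ U * p → U ≡ 8 * R → 8 * R < 10 * p
    8R<10p U R n≡Up U≡8R = *-cancelʳ-< p (8 * R) (10 * p) (begin-strict
      8 * R * p              ≡⟨ cong (_* p) (sym U≡8R) ⟩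
      U * p                  ≡⟨ sym n≡Up ⟩
      n                      <⟨ n<10p² ⟩
      10 * (p * (p * 1))     ≡⟨ regroup₃ p ⟩
      10 * p * p             ∎)

    via-quotient : p ∣ n → mu ≡ 2 * p + 2 ⊎ mu ≡ 2 * p ∸ 2
    via-quotient (divides U n≡Up) =
      let R , U≡8R , 2R[R+1]≡pμ = eighth U (p * mu) (quotient-equation U n≡Up)
      in consecutive-product {p} {R} {mu} p-prime 5≤p 1≤μ (8R<10p U R n≡Up U≡8R) 2R[R+1]≡pμ


  pds-parameters : ∀ {p k lam mu c} → Prime p → 5 ≤ p → 1 ≤ mu →
                   lam * k + mu * c + k ≡ k * k → c + k + 1 ≡ 8 * p ^ 3 → 2 * k ≤ 8 * p ^ 3 →
                   lam * lam + mu * mu + 4 * k ≡ 16 * p ^ 2 + (2 * (lam * mu) + 4 * mu) →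
                   mu ≡ 2 * p + 2 ⊎ mu ≡ 2 * p ∸ 2
  pds-parameters {p} {k} {lam} {mu} {c} p-prime 5≤p 1≤μ pairs elements 2k≤v Δ≡16p² =
    from-gap (proj₁ t-decomposition) (trans (+-comm _ lam) (proj₂ t-decomposition))
    where
    open ≤-Reasoning
    instance
      p³≢0 : NonZero (p ^ 3)
      p³≢0 = m^n≢0 p 3 {{>-nonZero (≤-trans (s≤s z≤n) 5≤p)}}

    3≤v : 3 ≤ 8 * p ^ 3
    3≤v = ≤-trans (s≤s (s≤s (s≤s z≤n))) (m≤m*n 8 (p ^ 3))

    Δ≡δ² : lam * lam + mu * mu + 4 * k ≡ 4 * p * (4 * p) + (2 * (lam * mu) + 4 * mu)
    Δ≡δ² = trans Δ≡16p² (cong (_+ (2 * (lam * mu) + 4 * mu)) sixteen-p²)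
      where
      sixteen-p² : 16 * (p * (p * 1)) ≡ 4 * p * (4 * p)
      sixteen-p² = solve (p ∷ [])

    -- t = 2k + μ − λ is a natural number since λ < k
    λ≤2k+μ : lam ≤ 2 * k + mu
    λ≤2k+μ = ≤-trans (<⇒≤ (λ<k {(8 * p ^ 3)} {k} {lam} {mu} {c} pairs elements 3≤v 1≤μ)) (≤-trans (m≤n*m k 2) (m≤m+n (2 * k) mu))

    t-decomposition : ∃ λ t → lam + t ≡ 2 * k + mu
    t-decomposition = m≤n⇒∃[o]m+o≡n λ≤2k+μ

    from-gap : ∀ t → t + lam ≡ 2 * k + mu → mu ≡ 2 * p + 2 ⊎ mu ≡ 2 * p ∸ 2
    from-gap t t+λ = from-root (proj₁ n-decomposition) (proj₂ n-decomposition)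
      where
      t² : t * t ≡ 4 * p * (4 * p) + 4 * (8 * p ^ 3) * mu
      t² = gap-square {(8 * p ^ 3)} {k} {lam} {mu} {c} {4 * p} {t} pairs elements Δ≡δ² t+λ

      2t≤3v : 2 * t ≤ 3 * (8 * p ^ 3)
      2t≤3v = begin
        2 * t              ≤⟨ *-monoʳ-≤ 2 (≤-trans (m≤m+n t lam) (≤-reflexive t+λ)) ⟩
        2 * (2 * k + mu)   ≤⟨ *-monoʳ-≤ 2 (+-monoʳ-≤ (2 * k) (μ≤k {(8 * p ^ 3)} {k} {lam} {mu} {c} pairs elements 3≤v 1≤μ 2k≤v)) ⟩
        2 * (2 * k + k)    ≡⟨ solve (k ∷ []) ⟩
        3 * (2 * k)        ≤⟨ *-monoʳ-≤ 3 2k≤v ⟩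
        3 * (8 * p ^ 3)    ∎

      -- t lies below the middle interval [10p² , 16p³ − 10p²] excluded by the gap
      t<10p² : t < 10 * p ^ 2
      t<10p² = ≰⇒> λ 10p²≤t → <⇒≱ (parabola-too-high 5≤p)
        (parabola-gap 10p²≤t (room {p} {t} 5≤p 2t≤3v) (gap-quadratic {8 * p ^ 3} {mu} {4 * p} {t} t² (gap-bound {k} {lam} {mu} {4 * p} {t} Δ≡δ² t+λ)))

      -- n = t − 4p = 2(k − r)
      n-decomposition : ∃ λ n → 4 * p + n ≡ t
      n-decomposition = m≤n⇒∃[o]m+o≡n (square-≥ (4 * p) t _ t²)

      from-root : ∀ n → 4 * p + n ≡ t → mu ≡ 2 * p + 2 ⊎ mu ≡ 2 * p ∸ 2
      from-root n δ+n≡t = small-root p-prime 5≤p 1≤μ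
        (square-shift (4 * p) n _ (trans (cong (λ x → x * x) δ+n≡t) t²))
        (≤-<-trans (≤-trans (m≤n+m n (4 * p)) (≤-reflexive δ+n≡t)) t<10p²)

open import Data.Integer using (ℤ; +_)
open import Data.Product using (_,_)
open Counting using (pds-counting; nontrivial⇒μ≥1)
open Discriminant using (Δ-in-ℕ)
open EightPCubed using (pds-parameters)

lemma4 : (p : ℕ) → Prime p → 5 ≤ p →
         (G : FiniteAbelianGroup (8 * p ^ 3)) →
         (D : Subset G) → (k lam mu : ℕ) →
         IsPDS G D k lam mu → IsRegular G D → ¬ IsTrivial G D →
         2 * k ≤ 8 * p ^ 3 →
         ((+ lam Data.Integer.- + mu) Data.Integer.* (+ lam Data.Integer.- + mu)
            Data.Integer.+ (+ 4) Data.Integer.* (+ k Data.Integer.- + mu))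
           ≡ + (16 * p ^ 2) →
         (mu ≡ 2 * p + 2) ⊎ (mu ≡ 2 * p ∸ 2)
lemma4 p p-prime 5≤p G D k lam mu pds regular nontrivial 2k≤v Δ≡16p² =
  let c , pairs , elements = pds-counting G D pds regular
  in pds-parameters {p} {k} {lam} {mu} {c} p-prime 5≤p (nontrivial⇒μ≥1 G D pds regular nontrivial)
       pairs elements 2k≤v (Δ-in-ℕ {k} {lam} {mu} Δ≡16p²)
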